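{- Let $s,t\in\mathbb{R}$ with $s\neq0$, $t\neq0$, $s^2+4t\neq0$, and let $q$ satisfy $|q|<|t|$. For all $n\in\mathbb{N}$, as power series in $x$, \[ \sum_{d=0}^{\infty}\genfrac{\{}{\}}{0pt}{}{n+d}{d}_{s,t}q^{\binom{n+d}{2}}x^d=\frac{1}{\{n\}_{s,t}!}\,\Theta_0^{(n)}(x,q). \]
   Context: $\varphi_{s,t}=\frac{s+\sqrt{s^2+4t}}{2}$, $\varphi'_{s,t}=\frac{s-\sqrt{s^2+4t}}{2}$. Generalized Fibonacci polynomials: $\{0\}_{s,t}=0$, $\{1\}_{s,t}=1$, $\{n+2\}_{s,t}=s\{n+1\}_{s,t}+t\{n\}_{s,t}$; $\{k\}_{s,t}!=\{1\}_{s,t}\cdots\{k\}_{s,t}$; $\genfrac{\{}{\}}{0pt}{}{n+d}{d}_{s,t}=\frac{\{n+1\}_{s,t}\cdots\{n+d\}_{s,t}}{\{d\}_{s,t}!}$. The Partial Theta function is $\Theta_0(x,q)=\sum_{k\geq0}q^{\binom{k}{2}}x^k$ and $\Theta_0^{(n)}(x,q)=\mathbf{D}_{s,t}^n\Theta_0(x,q)$, the $n$-fold $(s,t)$-derivative in $x$ computed termwise, with $(\mathbf{D}_{s,t}f)(x)=\frac{f(\varphi_{s,t}x)-f(\varphi'_{s,t}x)}{(\varphi_{s,t}-\varphi'_{s,t})x}$. -}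

module Defs where

open import Level using (_⊔_)
open import Data.Nat as ℕ using (ℕ; zero; suc)
open import Data.Nat.Combinatorics using (_C_)
open import Algebra.Bundles using (CommutativeRing)
open import Relation.Nullary using (¬_)

record IsFieldInverse {c ℓ} (R : CommutativeRing c ℓ)
       (inv : CommutativeRing.Carrier R → CommutativeRing.Carrier R) : Set (c ⊔ ℓ) where
  open CommutativeRing R
  field
    0≉1     : ¬ (0# ≈ 1#)
    inverse : ∀ x → ¬ (x ≈ 0#) → x * inv x ≈ 1#

-- Everything below is relative to a field (R , inv), parameters s t, and
-- a chosen square root r of s^2 + 4t (r * r ≈ s * s + 4 t).
module FibTheta {c ℓ} (R : CommutativeRing c ℓ)
       (inv : CommutativeRing.Carrier R → CommutativeRing.Carrier R)
       (s t r : CommutativeRing.Carrier R) where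
  open CommutativeRing R

  pow : Carrier → ℕ → Carrier
  pow x zero    = 1#
  pow x (suc k) = x * pow x k

  two four : Carrier
  two  = 1# + 1#
  four = two + two

  φ φ' : Carrier
  φ  = (s + r) * inv two
  φ' = (s - r) * inv two

  fib : ℕ → Carrier
  fib zero          = 0#
  fib (suc zero)    = 1#
  fib (suc (suc n)) = s * fib (suc n) + t * fib n

  fibFact : ℕ → Carrier
  fibFact zero    = 1#
  fibFact (suc k) = fibFact k * fib (suc k)

  fibRise : ℕ → ℕ → Carrier
  fibRise n zero    = 1#
  fibRise n (suc d) = fibRise n d * fib (n ℕ.+ suc d)

  fibBinom : ℕ → ℕ → Carrier
  fibBinom n d = fibRise n d * inv (fibFact d)

  PowerSeries : Set c
  PowerSeries = ℕ → Carrier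

  -- (s,t)-derivative, computed termwise:
  -- D x^(k+1) = (φ^(k+1) - φ'^(k+1)) x^(k+1) / ((φ - φ') x),  D x^0 = 0
  D : PowerSeries → PowerSeries
  D a k = a (suc k) * ((pow φ (suc k) - pow φ' (suc k)) * inv (φ - φ'))

  Dⁿ : ℕ → PowerSeries → PowerSeries
  Dⁿ zero    a = a
  Dⁿ (suc n) a = D (Dⁿ n a)

  Θ₀ : Carrier → PowerSeries
  Θ₀ q k = pow q (k C 2)

  Θ₀⁽_⁾ : ℕ → Carrier → PowerSeries
  Θ₀⁽ n ⁾ q = Dⁿ n (Θ₀ q)

-- φ and φ' are the two roots of X² = s X + t, and every root x satisfies
-- x^(m+1) = {m+1} x + t {m}.  Subtracting these for x = φ and x = φ' gives
-- Binet's formula {m} = (φ^m − φ'^m)/(φ − φ'), so the (s,t)-derivative acts on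
-- coefficients by D a k = {k+1} a(k+1), and n-fold differentiation multiplies
-- the coefficient of x^d by {d+1} ⋯ {d+n}.  Both {n}! {n+1}⋯{n+d} and
-- {d}! {d+1}⋯{d+n} equal {n+d}!, which turns the generalized binomial on the
-- left into the factor 1/{n}! on the right.
module Submission where

open import Defs
open import Data.Nat as ℕ using (ℕ; zero; suc)
open import Data.Nat.Combinatorics using (_C_)
import Data.Nat.Properties as ℕₚ
open import Algebra.Bundles using (CommutativeRing)
open import Relation.Nullary using (¬_)
import Relation.Binary.PropositionalEquality as ≡
import Relation.Binary.Reasoning.Setoid as SetoidReasoning
import Algebra.Properties.Ring as RingProperties
import Algebra.Solver.Ring.NaturalCoefficients.Default as SemiringSolver

module FieldProperties {c ℓ} (R : CommutativeRing c ℓ)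
       (inv : CommutativeRing.Carrier R → CommutativeRing.Carrier R)
       (isField : IsFieldInverse R inv) where
  open CommutativeRing R
  open IsFieldInverse isField
  open SetoidReasoning setoid
  open SemiringSolver commutativeSemiring

  *-inverse-cancelʳ : ∀ x {y} → ¬ y ≈ 0# → x * y * inv y ≈ x
  *-inverse-cancelʳ x {y} y≉0 = begin
    x * y * inv y   ≈⟨ *-assoc x y (inv y) ⟩
    x * (y * inv y) ≈⟨ *-congˡ (inverse y y≉0) ⟩
    x * 1#          ≈⟨ *-identityʳ x ⟩
    x               ∎

  *-nonzero : ∀ {x y} → ¬ x ≈ 0# → ¬ y ≈ 0# → ¬ x * y ≈ 0#
  *-nonzero {x} {y} x≉0 y≉0 xy≈0 = y≉0 (begin
    y             ≈⟨ *-inverse-cancelʳ y x≉0 ⟨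
    y * x * inv x ≈⟨ *-congʳ (trans (*-comm y x) xy≈0) ⟩
    0# * inv x    ≈⟨ zeroˡ (inv x) ⟩
    0#            ∎)

  *≈*⇒*inv≈inv* : ∀ {w x y z} → ¬ w ≈ 0# → ¬ y ≈ 0# →
                  w * x ≈ y * z → x * inv y ≈ inv w * z
  *≈*⇒*inv≈inv* {w} {x} {y} {z} w≉0 y≉0 wx≈yz = begin
    x * inv y               ≈⟨ *-congʳ (*-inverse-cancelʳ x w≉0) ⟨
    x * w * inv w * inv y
      ≈⟨ solve 4 (λ x w w⁻¹ y⁻¹ → x :* w :* w⁻¹ :* y⁻¹ := w⁻¹ :* (w :* x) :* y⁻¹)
                 refl x w (inv w) (inv y) ⟩
    inv w * (w * x) * inv y ≈⟨ *-congʳ (*-congˡ wx≈yz) ⟩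
    inv w * (y * z) * inv y
      ≈⟨ solve 4 (λ w⁻¹ y z y⁻¹ → w⁻¹ :* (y :* z) :* y⁻¹ := w⁻¹ :* z :* y :* y⁻¹)
                 refl (inv w) y z (inv y) ⟩
    inv w * z * y * inv y   ≈⟨ *-inverse-cancelʳ (inv w * z) y≉0 ⟩
    inv w * z               ∎

module Fibonacci {c ℓ} (R : CommutativeRing c ℓ)
       (inv : CommutativeRing.Carrier R → CommutativeRing.Carrier R)
       (s t r : CommutativeRing.Carrier R) where
  open CommutativeRing R
  open FibTheta R inv s t r
  open SetoidReasoning setoid
  open SemiringSolver commutativeSemiring
  open RingProperties ring
    using (x[y-z]≈xy-xz; -‿+-comm; -‿distribˡ-*; -‿distribʳ-*; -‿involutive; ⁻¹-anti-homo‿-; xyx⁻¹≈y)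

  IsRoot : Carrier → Set ℓ
  IsRoot x = x * x ≈ s * x + t

  pow-root : ∀ {x} → IsRoot x → ∀ m → pow x (suc m) ≈ fib (suc m) * x + t * fib m
  pow-root {x} _ zero = begin
    x * 1#          ≈⟨ *-comm x 1# ⟩
    1# * x          ≈⟨ +-identityʳ (1# * x) ⟨
    1# * x + 0#     ≈⟨ +-congˡ (zeroʳ t) ⟨
    1# * x + t * 0# ∎
  pow-root {x} root (suc m) = begin
    x * pow x (suc m)
      ≈⟨ *-congˡ (pow-root root m) ⟩
    x * (fib (suc m) * x + t * fib m)
      ≈⟨ solve 4 (λ x a b t → x :* (a :* x :+ t :* b) := a :* (x :* x) :+ t :* b :* x)
                 refl x (fib (suc m)) (fib m) t ⟩
    fib (suc m) * (x * x) + t * fib m * x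
      ≈⟨ +-congʳ (*-congˡ root) ⟩
    fib (suc m) * (s * x + t) + t * fib m * x
      ≈⟨ solve 5 (λ x a b s t → a :* (s :* x :+ t) :+ t :* b :* x
                                := (s :* a :+ t :* b) :* x :+ t :* a)
                 refl x (fib (suc m)) (fib m) s t ⟩
    fib (suc (suc m)) * x + t * fib (suc m) ∎

  pow-roots-difference : ∀ {x y} → IsRoot x → IsRoot y → ∀ m →
                         pow x (suc m) - pow y (suc m) ≈ fib (suc m) * (x - y)
  pow-roots-difference {x} {y} rootˣ rootʸ m = begin
    pow x (suc m) - pow y (suc m)
      ≈⟨ +-cong (pow-root rootˣ m) (-‿cong (pow-root rootʸ m)) ⟩
    (F * x + T) - (F * y + T)
      ≈⟨ +-congˡ (-‿+-comm (F * y) T) ⟨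
    (F * x + T) + (- (F * y) + - T)
      ≈⟨ solve 4 (λ a b c d → (a :+ b) :+ (c :+ d) := (a :+ c) :+ (b :+ d))
                 refl (F * x) T (- (F * y)) (- T) ⟩
    (F * x - F * y) + (T - T)
      ≈⟨ +-congˡ (-‿inverseʳ T) ⟩
    (F * x - F * y) + 0#
      ≈⟨ +-identityʳ _ ⟩
    F * x - F * y
      ≈⟨ x[y-z]≈xy-xz F x y ⟨
    F * (x - y) ∎
    where F = fib (suc m); T = t * fib m

  quadraticFormula-root : ∀ {h u} → two * h ≈ 1# → u * u ≈ s * s + four * t →
                 IsRoot ((s + u) * h)
  quadraticFormula-root {h} {u} 2h≈1 u²≈disc = begin
    (s + u) * h * ((s + u) * h)
      ≈⟨ solve 3 (λ s u h → (s :+ u) :* h :* ((s :+ u) :* h)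
                            := (s :* s :+ u :* u :+ con 2 :* (s :* u)) :* (h :* h))
                 refl s u h ⟩
    (s * s + u * u + two * (s * u)) * (h * h)
      ≈⟨ *-congʳ (+-congʳ (+-congˡ u²≈disc)) ⟩
    (s * s + (s * s + four * t) + two * (s * u)) * (h * h)
      ≈⟨ solve 4 (λ s u h t → (s :* s :+ (s :* s :+ (con 2 :+ con 2) :* t) :+ con 2 :* (s :* u))
                                :* (h :* h)
                              := s :* ((s :+ u) :* h) :* (con 2 :* h)
                                 :+ t :* ((con 2 :* h) :* (con 2 :* h)))
                 refl s u h t ⟩
    s * x * (two * h) + t * ((two * h) * (two * h))
      ≈⟨ +-cong (*-congˡ 2h≈1) (*-congˡ (*-cong 2h≈1 2h≈1)) ⟩
    s * x * 1# + t * (1# * 1#)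
      ≈⟨ solve 3 (λ s x t → s :* x :* con 1 :+ t :* (con 1 :* con 1) := s :* x :+ t)
                 refl s x t ⟩
    s * x + t ∎
    where x = (s + u) * h

  fibFact-*-fibRise : ∀ n d → fibFact n * fibRise n d ≈ fibFact (n ℕ.+ d)
  fibFact-*-fibRise n zero = begin
    fibFact n * 1#      ≈⟨ *-identityʳ (fibFact n) ⟩
    fibFact n           ≡⟨ ≡.cong fibFact (ℕₚ.+-identityʳ n) ⟨
    fibFact (n ℕ.+ 0)   ∎
  fibFact-*-fibRise n (suc d) = begin
    fibFact n * (fibRise n d * fib (n ℕ.+ suc d))
      ≈⟨ *-assoc (fibFact n) (fibRise n d) (fib (n ℕ.+ suc d)) ⟨
    fibFact n * fibRise n d * fib (n ℕ.+ suc d)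
      ≈⟨ *-congʳ (fibFact-*-fibRise n d) ⟩
    fibFact (n ℕ.+ d) * fib (n ℕ.+ suc d)
      ≡⟨ ≡.cong (λ m → fibFact (n ℕ.+ d) * fib m) (ℕₚ.+-suc n d) ⟩
    fibFact (suc (n ℕ.+ d))
      ≡⟨ ≡.cong fibFact (ℕₚ.+-suc n d) ⟨
    fibFact (n ℕ.+ suc d) ∎

  fibFact-*-fibRise-swap : ∀ n d → fibFact n * fibRise n d ≈ fibFact d * fibRise d n
  fibFact-*-fibRise-swap n d = begin
    fibFact n * fibRise n d ≈⟨ fibFact-*-fibRise n d ⟩
    fibFact (n ℕ.+ d)       ≡⟨ ≡.cong fibFact (ℕₚ.+-comm n d) ⟩
    fibFact (d ℕ.+ n)       ≈⟨ fibFact-*-fibRise d n ⟨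
    fibFact d * fibRise d n ∎

  fibRise-suc : ∀ d n → fibRise (suc d) n * fib (suc d) ≈ fibRise d (suc n)
  fibRise-suc d zero = *-congˡ (reflexive (≡.cong fib (ℕₚ.+-comm 1 d)))
  fibRise-suc d (suc n) = begin
    fibRise (suc d) n * fib (suc d ℕ.+ suc n) * fib (suc d)
      ≈⟨ solve 3 (λ a b c → a :* b :* c := a :* c :* b)
                 refl (fibRise (suc d) n) (fib (suc d ℕ.+ suc n)) (fib (suc d)) ⟩
    fibRise (suc d) n * fib (suc d) * fib (suc d ℕ.+ suc n)
      ≈⟨ *-cong (fibRise-suc d n) (reflexive (≡.cong fib (≡.sym (ℕₚ.+-suc d (suc n))))) ⟩
    fibRise d (suc n) * fib (d ℕ.+ suc (suc n)) ∎

  module WithField (isField : IsFieldInverse R inv) where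
    open IsFieldInverse isField
    open FieldProperties R inv isField

    binet : ∀ {x y} → IsRoot x → IsRoot y → ¬ x - y ≈ 0# → ∀ m →
            (pow x (suc m) - pow y (suc m)) * inv (x - y) ≈ fib (suc m)
    binet rootˣ rootʸ x-y≉0 m =
      trans (*-congʳ (pow-roots-difference rootˣ rootʸ m)) (*-inverse-cancelʳ (fib (suc m)) x-y≉0)

    fibFact-nonzero : (∀ k → ¬ fib (suc k) ≈ 0#) → ∀ m → ¬ fibFact m ≈ 0#
    fibFact-nonzero _ zero 1≈0 = 0≉1 (sym 1≈0)
    fibFact-nonzero fib≉0 (suc m) = *-nonzero (fibFact-nonzero fib≉0 m) (fib≉0 m)

    module CharacteristicRoots (2≉0 : ¬ two ≈ 0#) (r²≈disc : r * r ≈ s * s + four * t)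
                               (disc≉0 : ¬ s * s + four * t ≈ 0#) where
      2*2⁻¹≈1 : two * inv two ≈ 1#
      2*2⁻¹≈1 = inverse two 2≉0

      φ-root : IsRoot φ
      φ-root = quadraticFormula-root 2*2⁻¹≈1 r²≈disc

      φ'-root : IsRoot φ'
      φ'-root = quadraticFormula-root 2*2⁻¹≈1 (trans -r*-r≈r*r r²≈disc)
        where
        -r*-r≈r*r : - r * - r ≈ r * r
        -r*-r≈r*r = begin
          - r * - r    ≈⟨ -‿distribˡ-* r (- r) ⟨
          - (r * - r)  ≈⟨ -‿cong (-‿distribʳ-* r r) ⟨
          - - (r * r)  ≈⟨ -‿involutive (r * r) ⟩
          r * r        ∎

      φ-φ'≈r : φ - φ' ≈ r
      φ-φ'≈r = begin
        (s + r) * h - (s - r) * h    ≈⟨ +-congˡ (-‿distribˡ-* (s - r) h) ⟩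
        (s + r) * h + - (s - r) * h  ≈⟨ distribʳ h (s + r) (- (s - r)) ⟨
        (s + r - (s - r)) * h        ≈⟨ *-congʳ (+-congˡ (⁻¹-anti-homo‿- s r)) ⟩
        (s + r + (r - s)) * h
          ≈⟨ *-congʳ (solve 3 (λ s r n → s :+ r :+ (r :+ n) := s :+ (r :+ r) :+ n) refl s r (- s)) ⟩
        (s + (r + r) - s) * h        ≈⟨ *-congʳ (xyx⁻¹≈y s (r + r)) ⟩
        (r + r) * h                  ≈⟨ solve 2 (λ r h → (r :+ r) :* h := r :* (con 2 :* h)) refl r h ⟩
        r * (two * h)                ≈⟨ *-congˡ 2*2⁻¹≈1 ⟩
        r * 1#                       ≈⟨ *-identityʳ r ⟩
        r                            ∎
        where h = inv two

      φ-φ'≉0 : ¬ φ - φ' ≈ 0#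
      φ-φ'≉0 φ-φ'≈0 = disc≉0 (begin
        s * s + four * t ≈⟨ r²≈disc ⟨
        r * r            ≈⟨ *-congʳ (trans (sym φ-φ'≈r) φ-φ'≈0) ⟩
        0# * r           ≈⟨ zeroˡ r ⟩
        0#               ∎)

      D-coefficient : ∀ a k → D a k ≈ a (suc k) * fib (suc k)
      D-coefficient a k = *-congˡ (binet φ-root φ'-root φ-φ'≉0 k)

      Dⁿ-coefficient : ∀ n a d → Dⁿ n a d ≈ a (n ℕ.+ d) * fibRise d n
      Dⁿ-coefficient zero a d = sym (*-identityʳ (a d))
      Dⁿ-coefficient (suc n) a d = begin
        D (Dⁿ n a) d                                   ≈⟨ D-coefficient (Dⁿ n a) d ⟩
        Dⁿ n a (suc d) * fib (suc d)                   ≈⟨ *-congʳ (Dⁿ-coefficient n a (suc d)) ⟩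
        a (n ℕ.+ suc d) * fibRise (suc d) n * fib (suc d)
          ≈⟨ *-assoc (a (n ℕ.+ suc d)) (fibRise (suc d) n) (fib (suc d)) ⟩
        a (n ℕ.+ suc d) * (fibRise (suc d) n * fib (suc d)) ≈⟨ *-congˡ (fibRise-suc d n) ⟩
        a (n ℕ.+ suc d) * fibRise d (suc n)
          ≡⟨ ≡.cong (λ m → a m * fibRise d (suc n)) (ℕₚ.+-suc n d) ⟩
        a (suc n ℕ.+ d) * fibRise d (suc n)            ∎

mainTheorem17 : ∀ {c ℓ} (R : CommutativeRing c ℓ)
    (inv : CommutativeRing.Carrier R → CommutativeRing.Carrier R)
    → IsFieldInverse R inv
    → let open CommutativeRing R in
      ¬ (1# + 1# ≈ 0#)
    → (s t r : Carrier)
    → r * r ≈ s * s + ((1# + 1#) + (1# + 1#)) * t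
    → ¬ (s ≈ 0#) → ¬ (t ≈ 0#) → ¬ (s * s + ((1# + 1#) + (1# + 1#)) * t ≈ 0#)
    → (q : Carrier) (n : ℕ)
    → let open FibTheta R inv s t r in
      (∀ (k : ℕ) → ¬ (fib (ℕ.suc k) ≈ 0#))
    → ∀ (d : ℕ) →
        fibBinom n d * pow q ((n ℕ.+ d) C 2) ≈ inv (fibFact n) * Θ₀⁽ n ⁾ q d
mainTheorem17 R inv isField 2≉0 s t r r²≈disc _ _ disc≉0 q n fib≉0 d = begin
  fibRise n d * inv (fibFact d) * Q
    ≈⟨ *-congʳ (*≈*⇒*inv≈inv* (fibFact-nonzero fib≉0 n) (fibFact-nonzero fib≉0 d)
                              (fibFact-*-fibRise-swap n d)) ⟩
  inv (fibFact n) * fibRise d n * Q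
    ≈⟨ solve 3 (λ a b c → a :* b :* c := a :* (c :* b)) refl (inv (fibFact n)) (fibRise d n) Q ⟩
  inv (fibFact n) * (Q * fibRise d n)
    ≈⟨ *-congˡ (Dⁿ-coefficient n (Θ₀ q) d) ⟨
  inv (fibFact n) * Θ₀⁽ n ⁾ q d ∎
  where
  open CommutativeRing R
  open FibTheta R inv s t r
  open SetoidReasoning setoid
  open SemiringSolver commutativeSemiring
  open FieldProperties R inv isField
  open Fibonacci R inv s t r
  open WithField isField
  open CharacteristicRoots 2≉0 r²≈disc disc≉0
  Q = pow q ((n ℕ.+ d) C 2)
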